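{- Let $\mathcal{G}$ be an $\mathcal{L}$-structure containing $\mathcal{M}$ such that every finitely generated$/\mathcal{M}$ substructure of $\mathcal{G}$ belongs to $K(\mathcal{M})$. Let $x\in V(\mathcal{G})$ and $Y\subseteq V(\mathcal{G})$. If $y\triangleleft x$ for all $y\in Y$ and for every $m\in M(\mathcal{G})$ there is $y\in Y$ with $f(x,y)>m$, then $x$ is the $\triangleleft$-supremum of $Y$. Symmetrically, if $x\triangleleft y$ for all $y\in Y$ and for every $m\in M(\mathcal{G})$ there is $y\in Y$ with $f(x,y)>m$, then $x$ is the $\triangleleft$-infimum of $Y$.
   Context: Fix a countable structure $\mathcal{M}$ in a countable language $\mathcal{L}_0$ containing a binary relation symbol $<$ interpreted as a linear order on $\mathcal{M}$, whose Scott sentence $\phi$ has a model of cardinality $\aleph_1$ but none of cardinality $\aleph_2$. Let $\mathcal{L}$ extend $\mathcal{L}_0$ by unary predicates $V,M,N$, a binary relation $\triangleleft$ and a binary function symbol $f$. $K(\mathcal{M})$ is the class of countable $\mathcal{L}$-structures $\mathcal{A}$ such that: (1) $V(\mathcal{A}),M(\mathcal{A})$ partition the universe, $V(\mathcal{A})$ is finite and $M(\mathcal{A})$ (with its $\mathcal{L}_0$-structure) is $\mathcal{M}$; (2) $\triangleleft$ is a linear order on $V(\mathcal{A})$; (3) for $x\ne y$ in $V(\mathcal{A})$, $f(x,y)=f(y,x)\in M(\mathcal{A})$; (4) if $x\triangleleft y\triangleleft z$ are distinct elements of $V(\mathcal{A})$, then either $f(x,y)=f(x,z)=f(y,z)$,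 or $f(x,y)=f(x,z)<f(y,z)$, or $f(x,z)=f(y,z)<f(x,y)$; (5) $N(x)$ implies $x\in V(\mathcal{A})$. A finitely generated$/\mathcal{M}$ substructure of a structure $\mathcal{G}\supseteq\mathcal{M}$ is one of the form $\langle A_0\rangle\cup\mathcal{M}$ with $A_0$ a finite subset of $\mathcal{G}\setminus\mathcal{M}$. -}

module Defs where

open import Data.Nat using (ℕ)
open import Data.Fin using (Fin)
open import Data.Vec using (Vec; lookup; map)
open import Data.List using (List)
open import Data.List.Membership.Propositional using (_∈_)
open import Data.Product using (Σ; ∃; _×_)
open import Data.Sum using (_⊎_)
open import Relation.Nullary using (¬_)
open import Relation.Binary.PropositionalEquality using (_≡_; _≢_)
open import Function.Bundles using (_⇔_)

Countable : Set → Set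
Countable X = Σ (X → ℕ) λ e → ∀ {a b} → e a ≡ e b → a ≡ b

-- The distinguished binary symbol < of L₀
-- is built into the structures below as a separate field.
record Language : Set₁ where
  field
    FunSym : Set
    RelSym : Set
    funAr  : FunSym → ℕ
    relAr  : RelSym → ℕ

CountableLanguage : Language → Set
CountableLanguage L = Countable (Language.FunSym L) × Countable (Language.RelSym L)

record L0Str (L : Language) : Set₁ where
  open Language L
  field
    Carrier : Set
    fun     : (s : FunSym) → Vec Carrier (funAr s) → Carrier
    rel     : (r : RelSym) → Vec Carrier (relAr r) → Set
    _<_     : Carrier → Carrier → Set

record LStr (L : Language) : Set₁ where
  field
    reduct : L0Str L
  open L0Str reduct public
  field
    V M N : Carrier → Set
    _◁_   : Carrier → Carrier → Set
    f     : Carrier → Carrier → Carrier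

StrictLinearOn : {A : Set} → (A → Set) → (A → A → Set) → Set
StrictLinearOn {A} P _<_ =
  (∀ a → P a → ¬ (a < a)) ×
  (∀ a b c → P a → P b → P c → a < b → b < c → a < c) ×
  (∀ a b → P a → P b → (a < b) ⊎ (a ≡ b) ⊎ (b < a))

-- 𝓖 ⊇ 𝓜 : an embedding of L₀-structures ι : 𝓜 → 𝓖.
record Embedding {L : Language} (𝓜 𝓖 : L0Str L) : Set where
  open Language L
  private
    module M = L0Str 𝓜
    module G = L0Str 𝓖
  field
    ι      : M.Carrier → G.Carrier
    ι-inj  : ∀ {a b} → ι a ≡ ι b → a ≡ b
    ι-fun  : ∀ s (as : Vec M.Carrier (funAr s)) → ι (M.fun s as) ≡ G.fun s (map ι as)
    ι-rel  : ∀ r (as : Vec M.Carrier (relAr r)) → M.rel r as ⇔ G.rel r (map ι as)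
    ι-<    : ∀ a b → (a M.< b) ⇔ (ι a G.< ι b)

module _ {L : Language} {𝓜 : L0Str L} (𝓖 : LStr L)
         (e : Embedding 𝓜 (LStr.reduct 𝓖)) where
  open Language L
  open LStr 𝓖
  open Embedding e

  data Gen (A₀ : List Carrier) : Carrier → Set where
    gen  : ∀ {a} → a ∈ A₀ → Gen A₀ a
    base : ∀ m → Gen A₀ (ι m)
    app  : ∀ s (as : Vec Carrier (funAr s)) →
           (∀ (i : Fin (funAr s)) → Gen A₀ (lookup as i)) → Gen A₀ (fun s as)
    appf : ∀ {a b} → Gen A₀ a → Gen A₀ b → Gen A₀ (f a b)

  -- The substructure (of 𝓖, with induced structure) carried by S belongs
  -- to K(𝓜): conditions (1)–(5) together with countability.
  record InK (S : Carrier → Set) : Set where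
    field
      countable  : Countable (Σ Carrier S)
      partition  : ∀ a → S a → (V a ⊎ M a) × ¬ (V a × M a)
      V-finite   : Σ (List Carrier) λ l → ∀ a → S a → V a → a ∈ l
      M-is-𝓜     : ∀ a → S a → (M a ⇔ ∃ λ m → ι m ≡ a)
      ◁-on-V     : ∀ a b → S a → S b → a ◁ b → V a × V b
      ◁-linear   : StrictLinearOn (λ a → S a × V a) _◁_
      f-sym      : ∀ x y → S x → S y → V x → V y → x ≢ y →
                   (f x y ≡ f y x) × M (f x y)
      f-tree     : ∀ x y z → S x → S y → S z → V x → V y → V z →
                   x ≢ y → y ≢ z → x ≢ z → x ◁ y → y ◁ z →
                   ((f x y ≡ f x z) × (f x z ≡ f y z)) ⊎
                   ((f x y ≡ f x z) × (f x z < f y z)) ⊎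
                   ((f x z ≡ f y z) × (f y z < f x y))
      N⊆V        : ∀ a → S a → N a → V a

  AllFGinK : Set
  AllFGinK = ∀ (A₀ : List Carrier) →
             (∀ a → a ∈ A₀ → ¬ (∃ λ m → ι m ≡ a)) → InK (Gen A₀)

  _⊴_ : Carrier → Carrier → Set
  a ⊴ b = (a ◁ b) ⊎ (a ≡ b)

  IsSup : Carrier → (Carrier → Set) → Set
  IsSup x Y = (∀ y → Y y → y ⊴ x) ×
              (∀ z → V z → (∀ y → Y y → y ⊴ z) → x ⊴ z)

  IsInf : Carrier → (Carrier → Set) → Set
  IsInf x Y = (∀ y → Y y → x ⊴ y) ×
              (∀ z → V z → (∀ y → Y y → z ⊴ y) → z ⊴ x)

module Submission where

-- Every axiom of K(𝓜) used here mentions at most three points of V(𝓖), so it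
-- holds in 𝓖 because it holds in the substructure generated by those points.
-- The tree axiom (4) then says that f(x, ·) grows towards x: if z lies strictly
-- between x and y, then f(x,y) ≤ f(x,z).  Now let z be an upper bound of Y with
-- z ◁ x.  Choosing y ∈ Y with f(x,z) < f(x,y), either y = z or z lies strictly
-- between y and x, and both contradict the monotonicity.  So no upper bound lies
-- below x, which makes x the supremum; the infimum case is the mirror image.

open import Defs
open import Data.Product using (∃; _×_; _,_; proj₁; proj₂)
open import Data.Sum using (_⊎_; inj₁; inj₂)
open import Data.Empty using (⊥-elim)
open import Data.List using ([]; _∷_)
open import Data.List.Relation.Unary.All using (All; []; _∷_; lookup)
open import Data.List.Relation.Unary.Any using (here; there)
open import Relation.Nullary using (¬_)
open import Relation.Binary.PropositionalEquality using (_≡_; _≢_; refl; sym; subst; subst₂)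
open import Function.Bundles using (Equivalence)

module SupremumByUnboundedDistance {L : Language} {𝓜 : L0Str L}
  (<-strictLinear : StrictLinearOn (λ _ → L0Str.Carrier 𝓜) (L0Str._<_ 𝓜))
  (𝓖 : LStr L) (e : Embedding 𝓜 (LStr.reduct 𝓖)) (fg∈K : AllFGinK 𝓖 e) where

  open LStr 𝓖
  open Embedding e
  open InK

  InImage : Carrier → Set
  InImage a = ∃ λ m → ι m ≡ a

  <-irrefl-image : ∀ {a} → InImage a → ¬ (a < a)
  <-irrefl-image (m , refl) a<a = proj₁ <-strictLinear m m (Equivalence.from (ι-< m m) a<a)

  <-trans-image : ∀ {a b c} → InImage a → InImage b → InImage c → a < b → b < c → a < c
  <-trans-image (m₁ , refl) (m₂ , refl) (m₃ , refl) a<b b<c =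
    Equivalence.to (ι-< m₁ m₃)
      (proj₁ (proj₂ <-strictLinear) m₁ m₂ m₃ m₁ m₂ m₃
        (Equivalence.from (ι-< m₁ m₂) a<b) (Equivalence.from (ι-< m₂ m₃) b<c))

  _≤_ : Carrier → Carrier → Set
  a ≤ b = (a ≡ b) ⊎ (a < b)

  ≤⇒≯-image : ∀ {a b} → InImage a → InImage b → a ≤ b → ¬ (b < a)
  ≤⇒≯-image _   b∈ (inj₁ refl) = <-irrefl-image b∈
  ≤⇒≯-image a∈ b∈ (inj₂ a<b) b<a = <-irrefl-image a∈ (<-trans-image a∈ b∈ a∈ a<b b<a)

  V∩image-empty : ∀ {a} → V a → ¬ InImage a
  V∩image-empty Va (m , refl) =
    proj₂ (partition K₀ (ι m) (base m))
      (Va , Equivalence.from (M-is-𝓜 K₀ (ι m) (base m)) (m , refl))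
    where K₀ = fg∈K [] (λ _ ())

  ⟨_⟩∈K : ∀ {A₀} → All V A₀ → InK 𝓖 e (Gen 𝓖 e A₀)
  ⟨ VA₀ ⟩∈K = fg∈K _ (λ _ a∈A₀ → V∩image-empty (lookup VA₀ a∈A₀))

  1st : ∀ {A₀ a} → Gen 𝓖 e (a ∷ A₀) a
  1st = gen (here refl)

  2nd : ∀ {A₀ a b} → Gen 𝓖 e (a ∷ b ∷ A₀) b
  2nd = gen (there (here refl))

  3rd : ∀ {A₀ a b c} → Gen 𝓖 e (a ∷ b ∷ c ∷ A₀) c
  3rd = gen (there (there (here refl)))

  ◁-irrefl : ∀ {a} → V a → ¬ (a ◁ a)
  ◁-irrefl Va = proj₁ (◁-linear ⟨ Va ∷ [] ⟩∈K) _ (1st , Va)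

  ◁⇒≢ : ∀ {a b} → V a → a ◁ b → a ≢ b
  ◁⇒≢ Va a◁b refl = ◁-irrefl Va a◁b

  ◁-trans : ∀ {a b c} → V a → V b → V c → a ◁ b → b ◁ c → a ◁ c
  ◁-trans Va Vb Vc =
    proj₁ (proj₂ (◁-linear ⟨ Va ∷ Vb ∷ Vc ∷ [] ⟩∈K)) _ _ _ (1st , Va) (2nd , Vb) (3rd , Vc)

  ◁-trichotomy : ∀ {a b} → V a → V b → (a ◁ b) ⊎ (a ≡ b) ⊎ (b ◁ a)
  ◁-trichotomy Va Vb = proj₂ (proj₂ (◁-linear ⟨ Va ∷ Vb ∷ [] ⟩∈K)) _ _ (1st , Va) (2nd , Vb)

  f-comm : ∀ {a b} → V a → V b → a ≢ b → f a b ≡ f b a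
  f-comm Va Vb a≢b = proj₁ (f-sym ⟨ Va ∷ Vb ∷ [] ⟩∈K _ _ 1st 2nd Va Vb a≢b)

  f∈M : ∀ {a b} → V a → V b → a ≢ b → M (f a b)
  f∈M Va Vb a≢b = proj₂ (f-sym ⟨ Va ∷ Vb ∷ [] ⟩∈K _ _ 1st 2nd Va Vb a≢b)

  f∈image : ∀ {a b} → V a → V b → a ≢ b → InImage (f a b)
  f∈image Va Vb a≢b =
    Equivalence.to (M-is-𝓜 ⟨ Va ∷ Vb ∷ [] ⟩∈K _ (appf 1st 2nd)) (f∈M Va Vb a≢b)

  f-tree-◁ : ∀ {a b c} → V a → V b → V c → a ◁ b → b ◁ c →
             ((f a b ≡ f a c) × (f a c ≡ f b c)) ⊎
             ((f a b ≡ f a c) × (f a c < f b c)) ⊎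
             ((f a c ≡ f b c) × (f b c < f a b))
  f-tree-◁ Va Vb Vc a◁b b◁c =
    f-tree ⟨ Va ∷ Vb ∷ Vc ∷ [] ⟩∈K _ _ _ 1st 2nd 3rd Va Vb Vc
      (◁⇒≢ Va a◁b) (◁⇒≢ Vb b◁c) (◁⇒≢ Va (◁-trans Va Vb Vc a◁b b◁c)) a◁b b◁c

  StrictlyBetween : Carrier → Carrier → Carrier → Set
  StrictlyBetween y z x = ((y ◁ z) × (z ◁ x)) ⊎ ((x ◁ z) × (z ◁ y))

  StrictlyBetween⇒≢ : ∀ {x y z} → V x → V y → V z → StrictlyBetween y z x → x ≢ y
  StrictlyBetween⇒≢ Vx Vy Vz (inj₁ (y◁z , z◁x)) x≡y = ◁⇒≢ Vy (◁-trans Vy Vz Vx y◁z z◁x) (sym x≡y)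
  StrictlyBetween⇒≢ Vx Vy Vz (inj₂ (x◁z , z◁y)) = ◁⇒≢ Vx (◁-trans Vx Vz Vy x◁z z◁y)

  f-between : ∀ {x y z} → V x → V y → V z → StrictlyBetween y z x → f x y ≤ f x z
  f-between {x} {y} {z} Vx Vy Vz between@(inj₁ (y◁z , z◁x)) =
    subst₂ _≤_ (f-comm Vy Vx (λ y≡x → StrictlyBetween⇒≢ Vx Vy Vz between (sym y≡x)))
               (f-comm Vz Vx (◁⇒≢ Vz z◁x))
               (fromTree (f-tree-◁ Vy Vz Vx y◁z z◁x))
    where
    fromTree : ((f y z ≡ f y x) × (f y x ≡ f z x)) ⊎ ((f y z ≡ f y x) × (f y x < f z x)) ⊎
               ((f y x ≡ f z x) × (f z x < f y z)) → f y x ≤ f z x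
    fromTree (inj₁ (_ , fyx≡fzx))        = inj₁ fyx≡fzx
    fromTree (inj₂ (inj₁ (_ , fyx<fzx))) = inj₂ fyx<fzx
    fromTree (inj₂ (inj₂ (fyx≡fzx , _))) = inj₁ fyx≡fzx
  f-between {x} {y} {z} Vx Vy Vz (inj₂ (x◁z , z◁y)) with f-tree-◁ Vx Vz Vy x◁z z◁y
  ... | inj₁ (fxz≡fxy , _)              = inj₁ (sym fxz≡fxy)
  ... | inj₂ (inj₁ (fxz≡fxy , _))       = inj₁ (sym fxz≡fxy)
  ... | inj₂ (inj₂ (fxy≡fzy , fzy<fxz)) = inj₂ (subst (_< f x z) (sym fxy≡fzy) fzy<fxz)

  Unbounded : Carrier → (Carrier → Set) → Set
  Unbounded x Y = ∀ m → M m → ∃ λ y → Y y × (m < f x y)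

  f-not-farther : ∀ {x y z} → V x → V y → V z → x ≢ z →
                  (y ≡ z) ⊎ StrictlyBetween y z x → ¬ (f x z < f x y)
  f-not-farther Vx Vy Vz x≢z (inj₁ refl) = <-irrefl-image (f∈image Vx Vz x≢z)
  f-not-farther Vx Vy Vz x≢z (inj₂ between) =
    ≤⇒≯-image (f∈image Vx Vy (StrictlyBetween⇒≢ Vx Vy Vz between)) (f∈image Vx Vz x≢z)
      (f-between Vx Vy Vz between)

  no-bound-beyond : ∀ {x z Y} → V x → V z → x ≢ z → (∀ y → Y y → V y) → Unbounded x Y →
                    ¬ (∀ y → Y y → (y ≡ z) ⊎ StrictlyBetween y z x)
  no-bound-beyond {x} {z} Vx Vz x≢z YV unbounded beyond =
    let y , Yy , fxz<fxy = unbounded (f x z) (f∈M Vx Vz x≢z)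
    in f-not-farther Vx (YV y Yy) Vz x≢z (beyond y Yy) fxz<fxy

  isSup : ∀ {x Y} → V x → (∀ y → Y y → V y) → (∀ y → Y y → y ◁ x) → Unbounded x Y →
          IsSup 𝓖 e x Y
  isSup {x} {Y} Vx YV below unbounded = (λ y Yy → inj₁ (below y Yy)) , least
    where
    least : ∀ z → V z → (∀ y → Y y → _⊴_ 𝓖 e y z) → _⊴_ 𝓖 e x z
    least z Vz bound with ◁-trichotomy Vx Vz
    ... | inj₁ x◁z         = inj₁ x◁z
    ... | inj₂ (inj₁ x≡z)  = inj₂ x≡z
    ... | inj₂ (inj₂ z◁x)  =
      ⊥-elim (no-bound-beyond Vx Vz (λ x≡z → ◁⇒≢ Vz z◁x (sym x≡z)) YV unbounded
                (λ y Yy → toBetween (bound y Yy)))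
      where
      toBetween : ∀ {y} → _⊴_ 𝓖 e y z → (y ≡ z) ⊎ StrictlyBetween y z x
      toBetween (inj₁ y◁z) = inj₂ (inj₁ (y◁z , z◁x))
      toBetween (inj₂ y≡z) = inj₁ y≡z

  isInf : ∀ {x Y} → V x → (∀ y → Y y → V y) → (∀ y → Y y → x ◁ y) → Unbounded x Y →
          IsInf 𝓖 e x Y
  isInf {x} {Y} Vx YV above unbounded = (λ y Yy → inj₁ (above y Yy)) , greatest
    where
    greatest : ∀ z → V z → (∀ y → Y y → _⊴_ 𝓖 e z y) → _⊴_ 𝓖 e z x
    greatest z Vz bound with ◁-trichotomy Vx Vz
    ... | inj₂ (inj₂ z◁x)  = inj₁ z◁x
    ... | inj₂ (inj₁ x≡z)  = inj₂ (sym x≡z)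
    ... | inj₁ x◁z         =
      ⊥-elim (no-bound-beyond Vx Vz (◁⇒≢ Vx x◁z) YV unbounded
                (λ y Yy → toBetween (bound y Yy)))
      where
      toBetween : ∀ {y} → _⊴_ 𝓖 e z y → (y ≡ z) ⊎ StrictlyBetween y z x
      toBetween (inj₁ z◁y) = inj₂ (inj₂ (x◁z , z◁y))
      toBetween (inj₂ z≡y) = inj₁ (sym z≡y)

open SupremumByUnboundedDistance using (isSup; isInf)

lemma4p11 : (L : Language) → CountableLanguage L →
    (𝓜 : L0Str L) → Countable (L0Str.Carrier 𝓜) →
    StrictLinearOn (λ _ → L0Str.Carrier 𝓜) (L0Str._<_ 𝓜) →
    (𝓖 : LStr L) → (e : Embedding 𝓜 (LStr.reduct 𝓖)) →
    AllFGinK 𝓖 e →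
    (x : LStr.Carrier 𝓖) → LStr.V 𝓖 x →
    (Y : LStr.Carrier 𝓖 → Set) → (∀ y → Y y → LStr.V 𝓖 y) →
    (((∀ y → Y y → LStr._◁_ 𝓖 y x) →
      (∀ m → LStr.M 𝓖 m → ∃ λ y → Y y × LStr._<_ 𝓖 m (LStr.f 𝓖 x y)) →
      IsSup 𝓖 e x Y) ×
     ((∀ y → Y y → LStr._◁_ 𝓖 x y) →
      (∀ m → LStr.M 𝓖 m → ∃ λ y → Y y × LStr._<_ 𝓖 m (LStr.f 𝓖 x y)) →
      IsInf 𝓖 e x Y))
lemma4p11 _ _ _ _ <-strictLinear 𝓖 e fg∈K _ Vx _ YV =
  isSup <-strictLinear 𝓖 e fg∈K Vx YV , isInf <-strictLinear 𝓖 e fg∈K Vx YV
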